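{- Let $n\geq 2$ be an integer and let $T_n^k$ denote the perfect $n$-ary tree of depth $k$. Then the ordinary generating function of the sequence $\left(\delta\left(T_n^{k+1}\right)\right)_{k\geq 0}$ is \[g(x)=\sum_{k\geq 0}\delta\left(T_n^{k+1}\right)x^k=\frac{2n^{2}}{(1-nx)^{2}(1-n^{2}x)^{2}}.\]
   Context: All graphs are finite, simple, undirected. For a connected graph $G$, $\delta(G)=\sum_{i,j\in V(G)} d(i,j)$ is the sum of shortest-path distances over all ordered pairs of vertices. The perfect $n$-ary tree of depth $k$, $T_n^k$, is the rooted tree in which the root has $n$ children, every vertex at depth less than $k$ has exactly $n$ children, and all leaves are at depth $k$ ($T_n^0$ is a single vertex). -}

module Defs where

open import Data.Nat as ℕ using (ℕ; zero; suc; _≤_)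
open import Data.Integer as ℤ using (ℤ; +_; -_)
open import Data.Fin using (Fin)
open import Data.List using (List; []; _∷_; [_]; _++_; length; map; concatMap; allFin; upTo)
open import Data.Nat.ListAction using (sum)
open import Data.List.Membership.Propositional using (_∈_)
open import Data.Product using (Σ; ∃; _×_)
open import Data.Sum using (_⊎_)
open import Relation.Binary.PropositionalEquality using (_≡_)

-- The perfect n-ary tree T_n^k.
-- Vertices: words (lists) over Fin n of length ≤ k; the empty word is
-- the root and the children of a word w are the words w ++ [a], a : Fin n.

words : (n j : ℕ) → List (List (Fin n))
words n zero    = [] ∷ []
words n (suc j) = concatMap (λ a → map (a ∷_) (words n j)) (allFin n)

vertices : (n k : ℕ) → List (List (Fin n))
vertices n k = concatMap (words n) (upTo (suc k))

Edge : (n k : ℕ) → List (Fin n) → List (Fin n) → Set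
Edge n k u v = (length u ≤ k) × (length v ≤ k) ×
  ((∃ λ (a : Fin n) → v ≡ u ++ [ a ]) ⊎ (∃ λ (a : Fin n) → u ≡ v ++ [ a ]))

data Walk (n k : ℕ) : List (Fin n) → List (Fin n) → ℕ → Set where
  here : ∀ {u} → length u ≤ k → Walk n k u u zero
  step : ∀ {u v w ℓ} → Edge n k u v → Walk n k v w ℓ → Walk n k u w (suc ℓ)

IsDist : (n k : ℕ) → List (Fin n) → List (Fin n) → ℕ → Set
IsDist n k u v d = Walk n k u v d × (∀ m → Walk n k u v m → d ≤ m)

-- w = δ(T_n^k): the sum of distances over all ordered pairs of vertices
IsWiener : (n k : ℕ) → ℕ → Set
IsWiener n k w =
  Σ (List (Fin n) → List (Fin n) → ℕ) λ D →
    (∀ u v → u ∈ vertices n k → v ∈ vertices n k → IsDist n k u v (D u v)) ×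
    (w ≡ sum (map (λ u → sum (map (D u) (vertices n k))) (vertices n k)))

Series : Set
Series = ℕ → ℤ

sumTo : ℕ → (ℕ → ℤ) → ℤ
sumTo zero    f = f zero
sumTo (suc m) f = sumTo m f ℤ.+ f (suc m)

_⊛_ : Series → Series → Series
(f ⊛ g) m = sumTo m (λ i → f i ℤ.* g (m ℕ.∸ i))

const : ℤ → Series
const c zero    = c
const c (suc _) = + 0

oneMinus : ℤ → Series
oneMinus c zero          = + 1
oneMinus c (suc zero)    = - c
oneMinus c (suc (suc _)) = + 0

denom : ℕ → Series
denom n = ((oneMinus (+ n) ⊛ oneMinus (+ n)) ⊛ oneMinus (+ (n ℕ.* n))) ⊛ oneMinus (+ (n ℕ.* n))

module Submission where

-- Write n = m + 1, N_k = |T_n^k|, S_k for the sum of the depths of the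
-- vertices of T_n^k, and W_k = δ(T_n^k).  The proof has three parts.
--
-- 1. Distances.  The explicit function dist (climb to the longest common
--    prefix, then descend) is realised by a walk and is a lower bound for
--    every walk, so it is the shortest-path distance; hence IsWiener n k w
--    holds exactly for w = wiener n k, the double sum of dist.
-- 2. Counting.  Splitting T_n^(k+1) by levels gives
--    S_(k+1) = S_k + (k+1) n^(k+1) and (n-1) N_k + 1 = n^(k+1); splitting it
--    into the root and the n subtrees below the children of the root gives
--    S_(k+1) = n (N_k + S_k) and W_(k+1) = n W_k + 2 n^(k+1) S_(k+1).
-- 3. Series.  Multiplying a series f by (1 - c x) yields f - c·x·f, and this
--    commutes with multiplication by any series.  Removing the factors of
--    (1 - n x)^2 (1 - n^2 x)^2 one by one turns the coefficients W_(k+1)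
--    successively into 2 n^(k+1) S_(k+1), 2 (k+1) n^(2k+2), 2 n^(2k+2), and
--    finally into the constant series 2 n^2.

open import Defs
open import Data.Nat as ℕ using (ℕ; zero; suc; _+_; _*_; _^_; _∸_; _≤_; z≤n; s≤s)
open import Data.Nat.Properties
  using (≤-refl; ≤-trans; ≤-reflexive; ≤-antisym; n≤1+n; m≤n⇒m≤1+n; n∸n≡0; +-∸-assoc;
         +-comm; +-assoc; *-comm; *-identityʳ; *-zeroʳ; *-distribˡ-+; +-commutativeSemigroup)
open import Data.Nat.ListAction using (sum)
open import Data.Nat.Tactic.RingSolver using (solve-∀)
open import Data.Nat.ListAction.Properties using (sum-++)
open import Algebra.Properties.CommutativeSemigroup +-commutativeSemigroup
  using (x∙yz≈y∙xz) renaming (interchange to +-interchange)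
open import Data.Bool using (Bool; true; false; if_then_else_)
open import Data.Fin using (Fin; zero; suc)
open import Data.Fin.Properties using (_≟_)
open import Data.List using (List; []; _∷_; [_]; _++_; length; map; concatMap; allFin; upTo; applyUpTo)
open import Data.List.Properties
  using (length-++; ++-identityʳ; map-++; map-cong; map-∘; map-tabulate; length-tabulate;
         map-upTo; upTo-∷ʳ; concatMap-map; concatMap-++)
open import Data.List.Membership.Propositional using (_∈_)
open import Data.List.Relation.Unary.Any using (here; there)
open import Data.List.Membership.Propositional.Properties using (∈-concat⁻′; ∈-map⁻; ∈-upTo⁻)
open import Data.Product using (∃; _×_; _,_; proj₁)
open import Data.Sum using (inj₁; inj₂)
open import Relation.Nullary using (does; yes; no)
open import Relation.Nullary.Decidable using (dec-true)
open import Function using (_∘_; id)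
open import Relation.Binary.PropositionalEquality hiding ([_])

-- Tree distance between words u and v: strip the common first letter while
-- the words agree; once they disagree, the path climbs from u to the root
-- and descends to v.
dist : ∀ {n} → List (Fin n) → List (Fin n) → ℕ
dist []      v       = length v
dist (a ∷ u) []      = length (a ∷ u)
dist (a ∷ u) (b ∷ v) =
  if does (a ≟ b) then dist u v else length (a ∷ u) + length (b ∷ v)

dist-self : ∀ {n} (u : List (Fin n)) → dist u u ≡ 0
dist-self []      = refl
dist-self (a ∷ u) rewrite dec-true (a ≟ a) refl = dist-self u

length-∷ʳ : ∀ {n} (u : List (Fin n)) a → length (u ++ [ a ]) ≡ suc (length u)
length-∷ʳ u a = trans (length-++ u) (+-comm (length u) 1)

dist-child : ∀ {n} (u : List (Fin n)) a v → dist (u ++ [ a ]) v ≤ suc (dist u v)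
dist-child []      a []      = ≤-refl
dist-child []      a (b ∷ v) with does (a ≟ b)
... | true  = ≤-trans (n≤1+n _) (n≤1+n _)
... | false = ≤-refl
dist-child (c ∷ u) a []      rewrite length-∷ʳ u a = ≤-refl
dist-child (c ∷ u) a (b ∷ v) with does (c ≟ b)
... | true  = dist-child u a v
... | false rewrite length-∷ʳ u a = ≤-refl

dist-parent : ∀ {n} (u : List (Fin n)) a v → dist u v ≤ suc (dist (u ++ [ a ]) v)
dist-parent []      a []      = z≤n
dist-parent []      a (b ∷ v) with does (a ≟ b)
... | true  = ≤-refl
... | false = ≤-trans (n≤1+n _) (n≤1+n _)
dist-parent (c ∷ u) a []      rewrite length-∷ʳ u a = ≤-trans (n≤1+n _) (n≤1+n _)
dist-parent (c ∷ u) a (b ∷ v) with does (c ≟ b)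
... | true  = dist-parent u a v
... | false rewrite length-∷ʳ u a = ≤-trans (n≤1+n _) (n≤1+n _)

dist-≤-walk : ∀ {n k u w ℓ} → Walk n k u w ℓ → dist u w ≤ ℓ
dist-≤-walk {u = u} (here _) = ≤-reflexive (dist-self u)
dist-≤-walk {u = u} {w} (step (_ , _ , inj₁ (a , refl)) r) =
  ≤-trans (dist-parent u a w) (s≤s (dist-≤-walk r))
dist-≤-walk {w = w} (step {v = v} (_ , _ , inj₂ (a , refl)) r) =
  ≤-trans (dist-child v a w) (s≤s (dist-≤-walk r))

edge-sym : ∀ {n k u v} → Edge n k u v → Edge n k v u
edge-sym (p , q , inj₁ e) = q , p , inj₂ e
edge-sym (p , q , inj₂ e) = q , p , inj₁ e

walk-++ : ∀ {n k u v w ℓ₁ ℓ₂} → Walk n k u v ℓ₁ → Walk n k v w ℓ₂ → Walk n k u w (ℓ₁ + ℓ₂)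
walk-++ (here _)   r = r
walk-++ (step e q) r = step e (walk-++ q r)

walk-reverse : ∀ {n k u v ℓ} → Walk n k u v ℓ → Walk n k v u ℓ
walk-reverse (here p) = here p
walk-reverse {n} {k} {u} {v} (step {ℓ = ℓ} e r) =
  subst (Walk n k v u) (+-comm ℓ 1)
    (walk-++ (walk-reverse r) (step (edge-sym e) (here (proj₁ e))))

walk-below : ∀ {n k u v ℓ} (a : Fin n) → Walk n k u v ℓ → Walk n (suc k) (a ∷ u) (a ∷ v) ℓ
walk-below a (here p) = here (s≤s p)
walk-below a (step (p , q , inj₁ (b , e)) r) =
  step (s≤s p , s≤s q , inj₁ (b , cong (a ∷_) e)) (walk-below a r)
walk-below a (step (p , q , inj₂ (b , e)) r) =
  step (s≤s p , s≤s q , inj₂ (b , cong (a ∷_) e)) (walk-below a r)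

walk-from-root : ∀ {n} k (v : List (Fin n)) → length v ≤ k → Walk n k [] v (length v)
walk-from-root k       []      _       = here z≤n
walk-from-root (suc k) (a ∷ v) (s≤s p) =
  step (z≤n , s≤s z≤n , inj₁ (a , refl)) (walk-below a (walk-from-root k v p))

walk-of-dist : ∀ {n} k (u v : List (Fin n)) → length u ≤ k → length v ≤ k →
  Walk n k u v (dist u v)
walk-of-dist k       []      v       p q = walk-from-root k v q
walk-of-dist k       (a ∷ u) []      p q = walk-reverse (walk-from-root k (a ∷ u) p)
walk-of-dist (suc k) (a ∷ u) (b ∷ v) p@(s≤s p′) q@(s≤s q′) with a ≟ b
... | yes refl = walk-below a (walk-of-dist k u v p′ q′)
... | no _     = walk-++ (walk-reverse (walk-from-root (suc k) (a ∷ u) p))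
                         (walk-from-root (suc k) (b ∷ v) q)

∈-concatMap⁻ : ∀ {A B : Set} (f : A → List B) {xs y} → y ∈ concatMap f xs →
  ∃ λ x → x ∈ xs × y ∈ f x
∈-concatMap⁻ f {xs} y∈ with ys , y∈ys , ys∈ ← ∈-concat⁻′ (map f xs) y∈
                        with x , x∈xs , refl ← ∈-map⁻ f ys∈ = x , x∈xs , y∈ys

words-length : ∀ {n} j {u : List (Fin n)} → u ∈ words n j → length u ≡ j
words-length zero    (here refl) = refl
words-length {n} (suc j) u∈
  with a , _ , u∈′ ← ∈-concatMap⁻ (λ a → map (a ∷_) (words n j)) {allFin n} u∈
  with w , w∈ , refl ← ∈-map⁻ (a ∷_) u∈′ = cong suc (words-length j w∈)

vertex-depth : ∀ {n} k {u : List (Fin n)} → u ∈ vertices n k → length u ≤ k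
vertex-depth {n} k u∈ with j , j∈ , u∈′ ← ∈-concatMap⁻ (words n) u∈ =
  subst (_≤ k) (sym (words-length j u∈′)) (ℕ.s≤s⁻¹ (∈-upTo⁻ j∈))

dist-isDist : ∀ {n} k {u v : List (Fin n)} → u ∈ vertices n k → v ∈ vertices n k →
  IsDist n k u v (dist u v)
dist-isDist k {u} {v} u∈ v∈ =
  walk-of-dist k u v (vertex-depth k u∈) (vertex-depth k v∈) , λ _ → dist-≤-walk

isDist-unique : ∀ {n k u v d d′} → IsDist n k u v d → IsDist n k u v d′ → d ≡ d′
isDist-unique (walk , shortest) (walk′ , shortest′) =
  ≤-antisym (shortest _ walk′) (shortest′ _ walk)

sumMap : ∀ {A : Set} → (A → ℕ) → List A → ℕ
sumMap f xs = sum (map f xs)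

sumMap-++ : ∀ {A : Set} (f : A → ℕ) xs ys → sumMap f (xs ++ ys) ≡ sumMap f xs + sumMap f ys
sumMap-++ f xs ys = trans (cong sum (map-++ f xs ys)) (sum-++ (map f xs) (map f ys))

sumMap-cong : ∀ {A : Set} {f g : A → ℕ} xs → (∀ {x} → x ∈ xs → f x ≡ g x) →
  sumMap f xs ≡ sumMap g xs
sumMap-cong []       eq = refl
sumMap-cong (x ∷ xs) eq = cong₂ _+_ (eq (here refl)) (sumMap-cong xs (eq ∘ there))

sumMap-+ : ∀ {A : Set} (f g : A → ℕ) xs → sumMap (λ x → f x + g x) xs ≡ sumMap f xs + sumMap g xs
sumMap-+ f g []       = refl
sumMap-+ f g (x ∷ xs) =
  trans (cong (f x + g x +_) (sumMap-+ f g xs)) (+-interchange (f x) (g x) _ _)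

sumMap-* : ∀ {A : Set} c (f : A → ℕ) xs → sumMap (λ x → c * f x) xs ≡ c * sumMap f xs
sumMap-* c f []       = sym (*-zeroʳ c)
sumMap-* c f (x ∷ xs) =
  trans (cong (c * f x +_) (sumMap-* c f xs)) (sym (*-distribˡ-+ c (f x) _))

sumMap-const : ∀ {A : Set} c (xs : List A) → sumMap (λ _ → c) xs ≡ length xs * c
sumMap-const c []       = refl
sumMap-const c (x ∷ xs) = cong (c +_) (sumMap-const c xs)

sumMap-swap : ∀ {A B : Set} (h : A → B → ℕ) xs ys →
  sumMap (λ x → sumMap (h x) ys) xs ≡ sumMap (λ y → sumMap (λ x → h x y) xs) ys
sumMap-swap h []       ys = sym (trans (sumMap-const 0 ys) (*-zeroʳ (length ys)))
sumMap-swap h (x ∷ xs) ys =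
  trans (cong (sumMap (h x) ys +_) (sumMap-swap h xs ys))
        (sym (sumMap-+ (h x) (λ y → sumMap (λ x → h x y) xs) ys))

sumMap-concatMap : ∀ {A B : Set} (f : B → ℕ) (g : A → List B) xs →
  sumMap f (concatMap g xs) ≡ sumMap (λ x → sumMap f (g x)) xs
sumMap-concatMap f g []       = refl
sumMap-concatMap f g (x ∷ xs) =
  trans (sumMap-++ f (g x) (concatMap g xs)) (cong (sumMap f (g x) +_) (sumMap-concatMap f g xs))

sumMap-allFin-suc : ∀ {m} (f : Fin (suc m) → ℕ) →
  sumMap f (allFin (suc m)) ≡ f zero + sumMap (f ∘ suc) (allFin m)
sumMap-allFin-suc f =
  cong (f zero +_) (cong sum (trans (map-tabulate suc f) (sym (map-tabulate id (f ∘ suc)))))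

sumMap-allFin-const : ∀ m c → sumMap (λ (_ : Fin m) → c) (allFin m) ≡ m * c
sumMap-allFin-const m c = trans (sumMap-const c (allFin m)) (cong (_* c) (length-tabulate {n = m} id))

sumMap-allFin-one : ∀ m (a : Fin (suc m)) P Q →
  sumMap (λ b → if does (a ≟ b) then P else Q) (allFin (suc m)) ≡ P + m * Q
sumMap-allFin-one m zero P Q =
  trans (sumMap-allFin-suc {m} (λ b → if does (zero ≟ b) then P else Q))
        (cong (P +_) (sumMap-allFin-const m Q))
sumMap-allFin-one (suc m) (suc a) P Q =
  trans (sumMap-allFin-suc {suc m} (λ b → if does (suc a ≟ b) then P else Q))
        (trans (cong (Q +_) (sumMap-allFin-one m a P Q)) (x∙yz≈y∙xz Q P _))

level-sum : ∀ {n} (f : List (Fin n) → ℕ) j →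
  sumMap f (words n (suc j)) ≡ sumMap (λ a → sumMap (f ∘ (a ∷_)) (words n j)) (allFin n)
level-sum {n} f j =
  trans (sumMap-concatMap f (λ a → map (a ∷_) (words n j)) (allFin n))
        (cong sum (map-cong (λ a → cong sum (sym (map-∘ (words n j)))) (allFin n)))

root-sum : ∀ {n} k (f : List (Fin n) → ℕ) →
  sumMap f (vertices n (suc k)) ≡
  f [] + sumMap (λ a → sumMap (f ∘ (a ∷_)) (vertices n k)) (allFin n)
root-sum {n} k f = cong (f [] +_) (begin
    sumMap f (concatMap (words n) (applyUpTo suc (suc k)))
  ≡⟨ cong (sumMap f) (trans (cong (concatMap (words n)) (sym (map-upTo suc (suc k))))
                            (concatMap-map (words n) suc (upTo (suc k)))) ⟩
    sumMap f (concatMap (words n ∘ suc) (upTo (suc k)))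
  ≡⟨ sumMap-concatMap f (words n ∘ suc) (upTo (suc k)) ⟩
    sumMap (λ j → sumMap f (words n (suc j))) (upTo (suc k))
  ≡⟨ cong sum (map-cong (level-sum f) (upTo (suc k))) ⟩
    sumMap (λ j → sumMap (λ a → sumMap (f ∘ (a ∷_)) (words n j)) (allFin n)) (upTo (suc k))
  ≡⟨ sumMap-swap (λ j a → sumMap (f ∘ (a ∷_)) (words n j)) (upTo (suc k)) (allFin n) ⟩
    sumMap (λ a → sumMap (λ j → sumMap (f ∘ (a ∷_)) (words n j)) (upTo (suc k))) (allFin n)
  ≡⟨ cong sum (map-cong (λ a → sym (sumMap-concatMap (f ∘ (a ∷_)) (words n) (upTo (suc k))))
                        (allFin n)) ⟩
    sumMap (λ a → sumMap (f ∘ (a ∷_)) (vertices n k)) (allFin n) ∎)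
  where open ≡-Reasoning

vertices-suc : ∀ n k → vertices n (suc k) ≡ vertices n k ++ words n (suc k)
vertices-suc n k = begin
    concatMap (words n) (upTo (suc (suc k)))
  ≡⟨ cong (concatMap (words n)) (sym (upTo-∷ʳ (suc k))) ⟩
    concatMap (words n) (upTo (suc k) ++ [ suc k ])
  ≡⟨ concatMap-++ (words n) (upTo (suc k)) [ suc k ] ⟩
    vertices n k ++ (words n (suc k) ++ [])
  ≡⟨ cong (vertices n k ++_) (++-identityʳ (words n (suc k))) ⟩
    vertices n k ++ words n (suc k) ∎
  where open ≡-Reasoning

length-as-sum : ∀ {A : Set} (xs : List A) → sumMap (λ _ → 1) xs ≡ length xs
length-as-sum xs = trans (sumMap-const 1 xs) (*-identityʳ (length xs))

level-size : ∀ n j → length (words n j) ≡ n ^ j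
level-size n zero    = refl
level-size n (suc j) = begin
    length (words n (suc j))
  ≡⟨ sym (length-as-sum (words n (suc j))) ⟩
    sumMap (λ _ → 1) (words n (suc j))
  ≡⟨ level-sum {n} (λ _ → 1) j ⟩
    sumMap (λ _ → sumMap (λ _ → 1) (words n j)) (allFin n)
  ≡⟨ sumMap-allFin-const n _ ⟩
    n * sumMap (λ _ → 1) (words n j)
  ≡⟨ cong (n *_) (trans (length-as-sum (words n j)) (level-size n j)) ⟩
    n ^ suc j ∎
  where open ≡-Reasoning

level-depth-sum : ∀ n j → sumMap length (words n j) ≡ j * n ^ j
level-depth-sum n j = begin
    sumMap length (words n j)
  ≡⟨ sumMap-cong (words n j) (words-length j) ⟩
    sumMap (λ _ → j) (words n j)
  ≡⟨ sumMap-const j (words n j) ⟩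
    length (words n j) * j
  ≡⟨ trans (cong (_* j) (level-size n j)) (*-comm (n ^ j) j) ⟩
    j * n ^ j ∎
  where open ≡-Reasoning

order depthSum : ℕ → ℕ → ℕ
order    n k = length (vertices n k)
depthSum n k = sumMap length (vertices n k)

doubleSum : ∀ {A : Set} → (A → A → ℕ) → List A → ℕ
doubleSum F xs = sumMap (λ u → sumMap (F u) xs) xs

wiener : ℕ → ℕ → ℕ
wiener n k = doubleSum dist (vertices n k)

isWiener-wiener : ∀ n k → IsWiener n k (wiener n k)
isWiener-wiener n k = dist , (λ u v u∈ v∈ → dist-isDist k u∈ v∈) , refl

isWiener-unique : ∀ {n k w} → IsWiener n k w → w ≡ wiener n k
isWiener-unique {n} {k} (D , isDist , refl) =
  sumMap-cong (vertices n k) λ {u} u∈ → sumMap-cong (vertices n k) λ {v} v∈ →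
    isDist-unique (isDist u v u∈ v∈) (dist-isDist k u∈ v∈)

order-suc : ∀ n k → order n (suc k) ≡ order n k + n ^ suc k
order-suc n k = trans (cong length (vertices-suc n k))
  (trans (length-++ (vertices n k)) (cong (order n k +_) (level-size n (suc k))))

order-power : ∀ m k → 1 + m * order (suc m) k ≡ suc m ^ suc k
order-power m zero    = refl
order-power m (suc k) = begin
    1 + m * order (suc m) (suc k)
  ≡⟨ cong (λ t → 1 + m * t) (order-suc (suc m) k) ⟩
    1 + m * (order (suc m) k + suc m ^ suc k)
  ≡⟨ trans (cong (1 +_) (*-distribˡ-+ m (order (suc m) k) (suc m ^ suc k)))
           (sym (+-assoc 1 (m * order (suc m) k) (m * suc m ^ suc k))) ⟩
    (1 + m * order (suc m) k) + m * suc m ^ suc k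
  ≡⟨ cong (_+ m * suc m ^ suc k) (order-power m k) ⟩
    suc m ^ suc (suc k) ∎
  where open ≡-Reasoning

depthSum-suc : ∀ n k → depthSum n (suc k) ≡ depthSum n k + suc k * n ^ suc k
depthSum-suc n k = trans (cong (sumMap length) (vertices-suc n k))
  (trans (sumMap-++ length (vertices n k) (words n (suc k)))
         (cong (depthSum n k +_) (level-depth-sum n (suc k))))

-- Depths measured from the parent of the root of a subtree.
shifted-depthSum : ∀ n k →
  sumMap (λ u → suc (length u)) (vertices n k) ≡ order n k + depthSum n k
shifted-depthSum n k = trans (sumMap-+ (λ _ → 1) length (vertices n k))
  (cong (_+ depthSum n k) (length-as-sum (vertices n k)))

-- Every vertex below a child of the root is one level deeper than in T_n^k.
depthSum-root : ∀ n k → depthSum n (suc k) ≡ n * (order n k + depthSum n k)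
depthSum-root n k = trans (root-sum {n} k length)
  (trans (sumMap-allFin-const n (sumMap (λ u → suc (length u)) (vertices n k)))
         (cong (n *_) (shifted-depthSum n k)))

doubleSum-if : ∀ {A : Set} (c : Bool) (X Y : A → A → ℕ) xs →
  doubleSum (λ u v → if c then X u v else Y u v) xs ≡
  (if c then doubleSum X xs else doubleSum Y xs)
doubleSum-if true  X Y xs = refl
doubleSum-if false X Y xs = refl

doubleSum-separable : ∀ {A : Set} (g : A → ℕ) xs →
  doubleSum (λ u v → g u + g v) xs ≡ length xs * sumMap g xs + length xs * sumMap g xs
doubleSum-separable g xs = begin
    sumMap (λ u → sumMap (λ v → g u + g v) xs) xs
  ≡⟨ cong sum (map-cong (λ u → trans (sumMap-+ (λ _ → g u) g xs)
                                      (cong (_+ sumMap g xs) (sumMap-const (g u) xs))) xs) ⟩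
    sumMap (λ u → length xs * g u + sumMap g xs) xs
  ≡⟨ sumMap-+ (λ u → length xs * g u) (λ _ → sumMap g xs) xs ⟩
    sumMap (λ u → length xs * g u) xs + sumMap (λ _ → sumMap g xs) xs
  ≡⟨ cong₂ _+_ (sumMap-* (length xs) g xs) (sumMap-const (sumMap g xs) xs) ⟩
    length xs * sumMap g xs + length xs * sumMap g xs ∎
  where open ≡-Reasoning

-- Distances from the subtree below the child a of the root to all of
-- T_n^(k+1): the root contributes the shifted depths; the subtree below a
-- contributes δ(T_n^k); each of the other m subtrees contributes the sum of
-- (depth u + 1) + (depth v + 1), i.e. twice |T_n^k|·(|T_n^k| + depthSum).
subtree-rows : ∀ m k (a : Fin (suc m)) →
  let V = vertices (suc m) k ; T = order (suc m) k + depthSum (suc m) k in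
  sumMap (λ u → sumMap (dist (a ∷ u)) (vertices (suc m) (suc k))) V ≡
  T + (wiener (suc m) k + m * (order (suc m) k * T + order (suc m) k * T))
subtree-rows m k a = begin
    sumMap (λ u → sumMap (dist (a ∷ u)) (vertices n (suc k))) V
  ≡⟨ cong sum (map-cong (λ u → root-sum k (dist (a ∷ u))) V) ⟩
    sumMap (λ u → suc (length u) + sumMap (λ b → cross b u) (allFin n)) V
  ≡⟨ sumMap-+ (λ u → suc (length u)) (λ u → sumMap (λ b → cross b u) (allFin n)) V ⟩
    sumMap (λ u → suc (length u)) V + sumMap (λ u → sumMap (λ b → cross b u) (allFin n)) V
  ≡⟨ cong₂ _+_ (shifted-depthSum n k) (sumMap-swap (λ u b → cross b u) V (allFin n)) ⟩
    T + sumMap (λ b → sumMap (cross b) V) (allFin n)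
  ≡⟨ cong (T +_) (cong sum (map-cong (λ b → doubleSum-if (does (a ≟ b)) dist apart V)
                                     (allFin n))) ⟩
    T + sumMap (λ b → if does (a ≟ b) then wiener n k else doubleSum apart V) (allFin n)
  ≡⟨ cong (T +_) (sumMap-allFin-one m a (wiener n k) (doubleSum apart V)) ⟩
    T + (wiener n k + m * doubleSum apart V)
  ≡⟨ cong (λ t → T + (wiener n k + m * t))
          (trans (doubleSum-separable (λ u → suc (length u)) V)
                 (cong (λ t → order n k * t + order n k * t) (shifted-depthSum n k))) ⟩
    T + (wiener n k + m * (order n k * T + order n k * T)) ∎
  where
  open ≡-Reasoning
  n : ℕ
  n = suc m
  V : List (List (Fin n))
  V = vertices n k
  T : ℕ
  T = order n k + depthSum n k
  -- distance between vertices in different subtrees of the root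
  apart : List (Fin n) → List (Fin n) → ℕ
  apart u v = suc (length u) + suc (length v)
  cross : Fin n → List (Fin n) → ℕ
  cross b u = sumMap (λ v → dist (a ∷ u) (b ∷ v)) V

wiener-arith : ∀ m N T W →
  suc m * T + suc m * (T + (W + m * (N * T + N * T))) ≡
  suc m * W + 2 * (1 + m * N) * (suc m * T)
wiener-arith = solve-∀

wiener-suc : ∀ m k → let n = suc m in
  wiener n (suc k) ≡ n * wiener n k + 2 * n ^ suc k * depthSum n (suc k)
wiener-suc m k = begin
    wiener n (suc k)
  ≡⟨ root-sum k (λ u → sumMap (dist u) (vertices n (suc k))) ⟩
    depthSum n (suc k) +
    sumMap (λ a → sumMap (λ u → sumMap (dist (a ∷ u)) (vertices n (suc k))) V) (allFin n)
  ≡⟨ cong (depthSum n (suc k) +_) (trans (cong sum (map-cong (subtree-rows m k) (allFin n)))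
                                          (sumMap-allFin-const n R)) ⟩
    depthSum n (suc k) + n * R
  ≡⟨ cong (_+ n * R) (depthSum-root n k) ⟩
    n * T + n * R
  ≡⟨ wiener-arith m N T (wiener n k) ⟩
    n * wiener n k + 2 * (1 + m * N) * (n * T)
  ≡⟨ cong₂ (λ p s → n * wiener n k + 2 * p * s) (order-power m k) (sym (depthSum-root n k)) ⟩
    n * wiener n k + 2 * n ^ suc k * depthSum n (suc k) ∎
  where
  open ≡-Reasoning
  n : ℕ
  n = suc m
  V : List (List (Fin n))
  V = vertices n k
  N T R : ℕ
  N = order n k
  T = N + depthSum n k
  R = T + (wiener n k + m * (N * T + N * T))

-- The integers are imported only here: their constructor +_ would make the
-- sections (x +_) on ℕ above ambiguous.
open import Data.Integer as ℤ using (ℤ; +_; -_)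
import Data.Integer.Properties as ℤP
import Data.Integer.Tactic.RingSolver as ℤ-Ring

-- Formal power series.  x·g is the shift of g, and every factor (1 - c x)
-- of the denominator is 1 - c·(x·1).  Multiplying by (1 - c x) on the right
-- therefore sends f to f - c·(x·f), and commutes with multiplication by f.
shift : Series → Series
shift g zero    = + 0
shift g (suc j) = g j

sumTo-cong : ∀ m {f g : ℕ → ℤ} → (∀ i → i ≤ m → f i ≡ g i) → sumTo m f ≡ sumTo m g
sumTo-cong zero    eq = eq 0 z≤n
sumTo-cong (suc m) eq =
  cong₂ ℤ._+_ (sumTo-cong m (λ i i≤m → eq i (m≤n⇒m≤1+n i≤m))) (eq (suc m) ≤-refl)

sumTo-zero : ∀ m {f : ℕ → ℤ} → (∀ i → i ≤ m → f i ≡ + 0) → sumTo m f ≡ + 0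
sumTo-zero zero    eq = eq 0 z≤n
sumTo-zero (suc m) eq =
  cong₂ ℤ._+_ (sumTo-zero m (λ i i≤m → eq i (m≤n⇒m≤1+n i≤m))) (eq (suc m) ≤-refl)

sumTo-linear : ∀ m c (f g : ℕ → ℤ) →
  sumTo m (λ i → f i ℤ.- c ℤ.* g i) ≡ sumTo m f ℤ.- c ℤ.* sumTo m g
sumTo-linear zero    c f g = refl
sumTo-linear (suc m) c f g =
  trans (cong (ℤ._+ (f (suc m) ℤ.- c ℤ.* g (suc m))) (sumTo-linear m c f g))
        (regroup (sumTo m f) (sumTo m g) (f (suc m)) (g (suc m)) c)
  where
  regroup : ∀ A B a b c →
    (A ℤ.- c ℤ.* B) ℤ.+ (a ℤ.- c ℤ.* b) ≡ (A ℤ.+ a) ℤ.- c ℤ.* (B ℤ.+ b)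
  regroup = ℤ-Ring.solve-∀

⊛-congˡ : ∀ {f f′ : Series} g → f ≗ f′ → f ⊛ g ≗ f′ ⊛ g
⊛-congˡ g eq m = sumTo-cong m (λ i _ → cong (ℤ._* g (m ∸ i)) (eq i))

⊛-congʳ : ∀ f {g g′ : Series} → g ≗ g′ → f ⊛ g ≗ f ⊛ g′
⊛-congʳ f eq m = sumTo-cong m (λ i _ → cong (f i ℤ.*_) (eq (m ∸ i)))

⊛-linearʳ : ∀ f g h c →
  f ⊛ (λ j → g j ℤ.- c ℤ.* h j) ≗ λ m → (f ⊛ g) m ℤ.- c ℤ.* (f ⊛ h) m
⊛-linearʳ f g h c m =
  trans (sumTo-cong m (λ i _ → distrib (f i) (g (m ∸ i)) (h (m ∸ i)) c))
        (sumTo-linear m c (λ i → f i ℤ.* g (m ∸ i)) (λ i → f i ℤ.* h (m ∸ i)))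
  where
  distrib : ∀ a x y c → a ℤ.* (x ℤ.- c ℤ.* y) ≡ a ℤ.* x ℤ.- c ℤ.* (a ℤ.* y)
  distrib = ℤ-Ring.solve-∀

-- In degree m+1 of a Cauchy product, the summands with i ≤ m meet the
-- right factor in degree (m-i)+1.
suc-∸ : ∀ {m i} → i ≤ m → suc m ∸ i ≡ suc (m ∸ i)
suc-∸ = +-∸-assoc 1

⊛-identityʳ : ∀ f → f ⊛ const (+ 1) ≗ f
⊛-identityʳ f zero    = ℤP.*-identityʳ (f 0)
⊛-identityʳ f (suc m) = begin
    sumTo m (λ i → f i ℤ.* const (+ 1) (suc m ∸ i)) ℤ.+
    f (suc m) ℤ.* const (+ 1) (suc m ∸ suc m)
  ≡⟨ cong₂ ℤ._+_ (sumTo-zero m (λ i i≤m → trans (cong (λ t → f i ℤ.* const (+ 1) t)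
                                                       (suc-∸ i≤m))
                                                 (ℤP.*-zeroʳ (f i))))
                 (cong (λ t → f (suc m) ℤ.* const (+ 1) t) (n∸n≡0 m)) ⟩
    + 0 ℤ.+ f (suc m) ℤ.* + 1
  ≡⟨ trans (ℤP.+-identityˡ _) (ℤP.*-identityʳ (f (suc m))) ⟩
    f (suc m) ∎
  where open ≡-Reasoning

⊛-shiftʳ : ∀ f g → f ⊛ shift g ≗ shift (f ⊛ g)
⊛-shiftʳ f g zero    = ℤP.*-zeroʳ (f 0)
⊛-shiftʳ f g (suc m) = begin
    sumTo m (λ i → f i ℤ.* shift g (suc m ∸ i)) ℤ.+ f (suc m) ℤ.* shift g (suc m ∸ suc m)
  ≡⟨ cong₂ ℤ._+_ (sumTo-cong m (λ i i≤m → cong (λ t → f i ℤ.* shift g t) (suc-∸ i≤m)))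
                 (trans (cong (λ t → f (suc m) ℤ.* shift g t) (n∸n≡0 m))
                        (ℤP.*-zeroʳ (f (suc m)))) ⟩
    (f ⊛ g) m ℤ.+ + 0
  ≡⟨ ℤP.+-identityʳ ((f ⊛ g) m) ⟩
    (f ⊛ g) m ∎
  where open ≡-Reasoning

shift-cong : ∀ {f g} → f ≗ g → shift f ≗ shift g
shift-cong eq zero    = refl
shift-cong eq (suc j) = eq j

oneMinus-shift : ∀ c → oneMinus c ≗ λ j → const (+ 1) j ℤ.- c ℤ.* shift (const (+ 1)) j
oneMinus-shift c zero          = constant-term c
  where
  constant-term : ∀ c → + 1 ≡ + 1 ℤ.- c ℤ.* + 0
  constant-term = ℤ-Ring.solve-∀
oneMinus-shift c (suc zero)    = linear-term c
  where
  linear-term : ∀ c → - c ≡ + 0 ℤ.- c ℤ.* + 1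
  linear-term = ℤ-Ring.solve-∀
oneMinus-shift c (suc (suc j)) = higher-term c
  where
  higher-term : ∀ c → + 0 ≡ + 0 ℤ.- c ℤ.* + 0
  higher-term = ℤ-Ring.solve-∀

⊛-oneMinus : ∀ f c → f ⊛ oneMinus c ≗ λ j → f j ℤ.- c ℤ.* shift f j
⊛-oneMinus f c j = begin
    (f ⊛ oneMinus c) j
  ≡⟨ ⊛-congʳ f (oneMinus-shift c) j ⟩
    (f ⊛ (λ i → const (+ 1) i ℤ.- c ℤ.* shift (const (+ 1)) i)) j
  ≡⟨ ⊛-linearʳ f (const (+ 1)) (shift (const (+ 1))) c j ⟩
    (f ⊛ const (+ 1)) j ℤ.- c ℤ.* (f ⊛ shift (const (+ 1))) j
  ≡⟨ cong₂ (λ s t → s ℤ.- c ℤ.* t) (⊛-identityʳ f j)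
           (trans (⊛-shiftʳ f (const (+ 1)) j) (shift-cong (⊛-identityʳ f) j)) ⟩
    f j ℤ.- c ℤ.* shift f j ∎
  where open ≡-Reasoning

⊛-oneMinus-assoc : ∀ f g c → f ⊛ (g ⊛ oneMinus c) ≗ (f ⊛ g) ⊛ oneMinus c
⊛-oneMinus-assoc f g c j = begin
    (f ⊛ (g ⊛ oneMinus c)) j
  ≡⟨ ⊛-congʳ f (⊛-oneMinus g c) j ⟩
    (f ⊛ (λ i → g i ℤ.- c ℤ.* shift g i)) j
  ≡⟨ ⊛-linearʳ f g (shift g) c j ⟩
    (f ⊛ g) j ℤ.- c ℤ.* (f ⊛ shift g) j
  ≡⟨ cong (λ t → (f ⊛ g) j ℤ.- c ℤ.* t) (⊛-shiftʳ f g j) ⟩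
    (f ⊛ g) j ℤ.- c ℤ.* shift (f ⊛ g) j
  ≡⟨ sym (⊛-oneMinus (f ⊛ g) c j) ⟩
    ((f ⊛ g) ⊛ oneMinus c) j ∎
  where open ≡-Reasoning

⊛-four-factors : ∀ f a b c d →
  f ⊛ (((oneMinus a ⊛ oneMinus b) ⊛ oneMinus c) ⊛ oneMinus d) ≗
  (((f ⊛ oneMinus a) ⊛ oneMinus b) ⊛ oneMinus c) ⊛ oneMinus d
⊛-four-factors f a b c d j = begin
    (f ⊛ (((A ⊛ B) ⊛ C) ⊛ D)) j
  ≡⟨ ⊛-oneMinus-assoc f ((A ⊛ B) ⊛ C) d j ⟩
    ((f ⊛ ((A ⊛ B) ⊛ C)) ⊛ D) j
  ≡⟨ ⊛-congˡ D (⊛-oneMinus-assoc f (A ⊛ B) c) j ⟩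
    (((f ⊛ (A ⊛ B)) ⊛ C) ⊛ D) j
  ≡⟨ ⊛-congˡ D (⊛-congˡ C (⊛-oneMinus-assoc f A b)) j ⟩
    ((((f ⊛ A) ⊛ B) ⊛ C) ⊛ D) j ∎
  where
  open ≡-Reasoning
  A = oneMinus a
  B = oneMinus b
  C = oneMinus c
  D = oneMinus d

peel : ∀ (F G : ℕ → ℤ) c → F 0 ≡ + 0 → (∀ k → F (suc k) ℤ.- c ℤ.* F k ≡ G k) →
  (F ∘ suc) ⊛ oneMinus c ≗ G
peel F G c F0 next zero    =
  trans (⊛-oneMinus (F ∘ suc) c 0) (trans (cong (λ t → F 1 ℤ.- c ℤ.* t) (sym F0)) (next 0))
peel F G c F0 next (suc j) = trans (⊛-oneMinus (F ∘ suc) c (suc j)) (next (suc j))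

-- The ring identities behind the four peeling steps, with N = n, E = n²,
-- p = n^k, p′ = n^(k+1), s = depthSum(T_n^k), s′ = depthSum(T_n^(k+1)), K = k.
depth-peel : ∀ N p p′ s s′ K → p′ ≡ N ℤ.* p → s′ ≡ s ℤ.+ (+ 1 ℤ.+ K) ℤ.* p′ →
  + 2 ℤ.* p′ ℤ.* s′ ℤ.- N ℤ.* (+ 2 ℤ.* p ℤ.* s) ≡ + 2 ℤ.* (+ 1 ℤ.+ K) ℤ.* (p′ ℤ.* p′)
depth-peel N p _ s _ K refl refl = identity N p s K
  where
  identity : ∀ N p s K →
    + 2 ℤ.* (N ℤ.* p) ℤ.* (s ℤ.+ (+ 1 ℤ.+ K) ℤ.* (N ℤ.* p)) ℤ.- N ℤ.* (+ 2 ℤ.* p ℤ.* s) ≡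
    + 2 ℤ.* (+ 1 ℤ.+ K) ℤ.* ((N ℤ.* p) ℤ.* (N ℤ.* p))
  identity = ℤ-Ring.solve-∀

level-peel : ∀ N E p p′ K → p′ ≡ N ℤ.* p → E ≡ N ℤ.* N →
  + 2 ℤ.* (+ 1 ℤ.+ K) ℤ.* (p′ ℤ.* p′) ℤ.- E ℤ.* (+ 2 ℤ.* K ℤ.* (p ℤ.* p)) ≡
  + 2 ℤ.* (p′ ℤ.* p′)
level-peel N _ p _ K refl refl = identity N p K
  where
  identity : ∀ N p K →
    + 2 ℤ.* (+ 1 ℤ.+ K) ℤ.* ((N ℤ.* p) ℤ.* (N ℤ.* p)) ℤ.- (N ℤ.* N) ℤ.* (+ 2 ℤ.* K ℤ.* (p ℤ.* p)) ≡
    + 2 ℤ.* ((N ℤ.* p) ℤ.* (N ℤ.* p))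
  identity = ℤ-Ring.solve-∀

square-peel : ∀ N E p p′ → p′ ≡ N ℤ.* p → E ≡ N ℤ.* N →
  + 2 ℤ.* (p′ ℤ.* p′) ℤ.- E ℤ.* (+ 2 ℤ.* (p ℤ.* p)) ≡ + 0
square-peel N _ p _ refl refl = identity N p
  where
  identity : ∀ N p →
    + 2 ℤ.* ((N ℤ.* p) ℤ.* (N ℤ.* p)) ℤ.- (N ℤ.* N) ℤ.* (+ 2 ℤ.* (p ℤ.* p)) ≡ + 0
  identity = ℤ-Ring.solve-∀

square-constant : ∀ N E p → p ≡ N ℤ.* + 1 → E ≡ N ℤ.* N →
  + 2 ℤ.* (p ℤ.* p) ℤ.- E ℤ.* + 0 ≡ + 2 ℤ.* E
square-constant N _ _ refl refl = identity N
  where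
  identity : ∀ N →
    + 2 ℤ.* ((N ℤ.* + 1) ℤ.* (N ℤ.* + 1)) ℤ.- (N ℤ.* N) ℤ.* + 0 ≡ + 2 ℤ.* (N ℤ.* N)
  identity = ℤ-Ring.solve-∀

-- The coefficient sequences met while peeling the denominator of the
-- generating function of δ(T_n^(k+1)), n = m + 1:
--   δ(T_n^k),  2n^k·depthSum(T_n^k),  2k·n^(2k),  2n^(2k);
-- each is the previous one times (1 - n x) or (1 - n² x), shifted by one.
module WienerSeries (m : ℕ) where

  n : ℕ
  n = suc m

  N E : ℤ
  N = + n
  E = + (n * n)

  power wienerSeq depthSeq levelSeq squareSeq : ℕ → ℤ
  power     k = + (n ^ k)
  wienerSeq k = + wiener n k
  depthSeq  k = + 2 ℤ.* power k ℤ.* + depthSum n k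
  levelSeq  k = + 2 ℤ.* + k ℤ.* (power k ℤ.* power k)
  squareSeq k = + 2 ℤ.* (power k ℤ.* power k)

  power-suc : ∀ k → power (suc k) ≡ N ℤ.* power k
  power-suc k = ℤP.pos-* n (n ^ k)

  E-square : E ≡ N ℤ.* N
  E-square = ℤP.pos-* n n

  wiener-step : ∀ k → wienerSeq (suc k) ℤ.- N ℤ.* wienerSeq k ≡ depthSeq (suc k)
  wiener-step k = trans (cong (ℤ._- N ℤ.* wienerSeq k) recurrence)
                        (cancel (N ℤ.* wienerSeq k) (depthSeq (suc k)))
    where
    cancel : ∀ a b → a ℤ.+ b ℤ.- a ≡ b
    cancel = ℤ-Ring.solve-∀
    recurrence : wienerSeq (suc k) ≡ N ℤ.* wienerSeq k ℤ.+ depthSeq (suc k)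
    recurrence = trans (cong +_ (wiener-suc m k))
      (trans (ℤP.pos-+ (n * wiener n k) _)
        (cong₂ ℤ._+_ (ℤP.pos-* n (wiener n k))
          (trans (ℤP.pos-* (2 * n ^ suc k) _)
                 (cong (ℤ._* + depthSum n (suc k)) (ℤP.pos-* 2 (n ^ suc k))))))

  depth-step : ∀ k → depthSeq (suc k) ℤ.- N ℤ.* depthSeq k ≡ levelSeq (suc k)
  depth-step k =
    depth-peel N (power k) (power (suc k)) (+ depthSum n k) (+ depthSum n (suc k)) (+ k)
      (power-suc k)
      (trans (cong +_ (depthSum-suc n k))
             (trans (ℤP.pos-+ (depthSum n k) _)
                    (cong (λ t → + depthSum n k ℤ.+ t) (ℤP.pos-* (suc k) (n ^ suc k)))))

  level-step : ∀ k → levelSeq (suc k) ℤ.- E ℤ.* levelSeq k ≡ squareSeq (suc k)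
  level-step k = level-peel N E (power k) (power (suc k)) (+ k) (power-suc k) E-square

  square-last : (squareSeq ∘ suc) ⊛ oneMinus E ≗ const (+ (2 * (n * n)))
  square-last zero    = trans (⊛-oneMinus (squareSeq ∘ suc) E 0)
    (trans (square-constant N E (power 1) (power-suc 0) E-square) (sym (ℤP.pos-* 2 (n * n))))
  square-last (suc j) = trans (⊛-oneMinus (squareSeq ∘ suc) E (suc j))
    (square-peel N E (power (suc j)) (power (suc (suc j))) (power-suc (suc j)) E-square)

  generating-function : (wienerSeq ∘ suc) ⊛ denom n ≗ const (+ (2 * (n * n)))
  generating-function j = begin
      ((wienerSeq ∘ suc) ⊛ denom n) j
    ≡⟨ ⊛-four-factors (wienerSeq ∘ suc) N N E E j ⟩
      (((((wienerSeq ∘ suc) ⊛ oneMinus N) ⊛ oneMinus N) ⊛ oneMinus E) ⊛ oneMinus E) j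
    ≡⟨ ⊛-congˡ (oneMinus E) (⊛-congˡ (oneMinus E) (⊛-congˡ (oneMinus N)
         (peel wienerSeq (depthSeq ∘ suc) N refl wiener-step))) j ⟩
      ((((depthSeq ∘ suc) ⊛ oneMinus N) ⊛ oneMinus E) ⊛ oneMinus E) j
    ≡⟨ ⊛-congˡ (oneMinus E) (⊛-congˡ (oneMinus E)
         (peel depthSeq (levelSeq ∘ suc) N refl depth-step)) j ⟩
      (((levelSeq ∘ suc) ⊛ oneMinus E) ⊛ oneMinus E) j
    ≡⟨ ⊛-congˡ (oneMinus E) (peel levelSeq (squareSeq ∘ suc) E refl level-step) j ⟩
      ((squareSeq ∘ suc) ⊛ oneMinus E) j
    ≡⟨ square-last j ⟩
      const (+ (2 * (n * n))) j ∎
    where open ≡-Reasoning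

mainTheorem6 : (n : ℕ) → 2 ≤ n →
    (∀ k → ∃ λ w → IsWiener n (suc k) w) ×
    (∀ (a : ℕ → ℕ) → (∀ k → IsWiener n (suc k) (a k)) →
      ∀ m → ((λ k → + (a k)) ⊛ denom n) m ≡ const (+ (2 * (n * n))) m)
mainTheorem6 (suc m) _ =
  (λ k → wiener (suc m) (suc k) , isWiener-wiener (suc m) (suc k)) ,
  λ a isWiener j →
    trans (⊛-congˡ (denom (suc m)) (λ k → cong +_ (isWiener-unique (isWiener k))) j)
          (WienerSeries.generating-function m j)
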